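{- Let $\mathcal G$ be the graph with vertex set $V=(\mathbb{N}\times\mathbb{N})\setminus\{(0,0)\}$ (where $\mathbb{N}=\{0,1,2,\dots\}$), in which two distinct vertices $(a,b),(c,d)$ are adjacent if and only if $a=c=0$, or $b=d=0$, or ($a<c$ and $b>d$), or ($a>c$ and $b<d$). Then $\rho(\mathcal G)=\omega$; that is, $\omega$ is a CR-ordinal.
   Context: Game of cops and robbers: on a graph $G$, the cop picks a start vertex, then the robber; they then alternately move (cop first) to an adjacent vertex or stay put; the cop wins if he lands on the robber's vertex; $G$ is cop-win if the cop has a winning strategy. Ordinal capture times: let $G$ be a graph of cardinality $\aleph_\beta$, let $\omega(G)=\omega_{\beta+1}$, and for a vertex $v$ let $N[v]$ be its closed neighborhood. Define relations $\le_\alpha$ ($\alpha<\omega(G)$) on $V(G)$ by: $u\le_0 v$ iff $u=v$; and $u\le_\alpha v$ iff for every $x\in N[u]$ there is $y\in N[v]$ and $\gamma<\alpha$ with $x\le_\gamma y$. Let $\eta(u,v)$ be the least ordinal $\alpha$ with $u\le_\alpha v$ (for finite values this is the time for a cop at $v$ to catch a robber at $u$ with the robber moving first, under optimal play). Let $\eta(v)$ be the least ordinal $\alpha$ such that $u\le_\alpha v$ for all $u\in V(G)$, and $\rho(G)=\sup_{v\in V(G)}\eta(v)$. An ordinal is a CR-ordinal if it equals $\rho(G)$ for some cop-win graph $G$. -}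

module Defs where

open import Data.Nat using (ℕ; zero; suc; _<_; _>_)
open import Data.Product using (Σ; ∃; _×_; _,_; proj₁; proj₂)
open import Data.Sum using (_⊎_)
open import Data.Empty using (⊥)
open import Relation.Nullary using (¬_)
open import Relation.Binary.PropositionalEquality using (_≡_; _≢_)

V : Set
V = Σ (ℕ × ℕ) (λ p → p ≢ (0 , 0))

_≐_ : V → V → Set
u ≐ v = proj₁ u ≡ proj₁ v

Adj : V → V → Set
Adj ((a , b) , _) ((c , d) , _) =
  ¬ ((a , b) ≡ (c , d)) ×
  ( (a ≡ 0 × c ≡ 0)
  ⊎ (b ≡ 0 × d ≡ 0)
  ⊎ (a < c × b > d)
  ⊎ (a > c × b < d))

InN : V → V → Set
InN u x = (x ≐ u) ⊎ Adj u x

-- The relations ≤_n for finite ordinals n, together with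
-- Below n x y  :⇔  ∃ γ < n, x ≤_γ y
mutual
  Le : ℕ → V → V → Set
  Le zero    u v = u ≐ v
  Le (suc n) u v = (x : V) → InN u x → Σ V (λ y → InN v y × Below (suc n) x y)

  Below : ℕ → V → V → Set
  Below zero    x y = ⊥
  Below (suc n) x y = Below n x y ⊎ Le n x y

Leω : V → V → Set
Leω u v = (x : V) → InN u x → Σ V (λ y → InN v y × ∃ (λ n → Le n x y))

-- η(v) ≤ α  :⇔  ∀ u, u ≤_α v   (the relations are monotone in α)
-- ρ(𝒢) = ω  :⇔  every η(v) ≤ ω, and no finite n bounds all η(v)
RhoIsω : Set
RhoIsω = ((v u : V) → Leω u v) × ((n : ℕ) → Σ V (λ v → ¬ ((u : V) → Le n u v)))

{-# OPTIONS --safe #-}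
module Submission where

open import Defs
open import Data.Nat using (ℕ; zero; suc; _<_; _≤_; _+_; _≟_; z≤n; s≤s)
open import Data.Nat.Properties
open import Data.Product using (Σ; _×_; _,_; proj₁; proj₂)
open import Data.Sum using (_⊎_; inj₁; inj₂)
open import Data.Empty using (⊥-elim)
open import Relation.Nullary using (¬_; yes; no)
open import Relation.Binary.PropositionalEquality using (_≡_; refl; sym; cong; ≢-sym)

-- The vertices (0 , b) form a clique, and (0 , B) is adjacent to every (a , b) with b < B.
-- So a cop at (0 , B) catches a robber at (a , b), b < B, within a + 1 rounds: the only
-- moves leaving the cop's neighbourhood go to some (c , d) with c < a and b < d, and the
-- cop answers with (0 , d + 1).  Every vertex, in particular every robber move, is caught
-- in this way from a clique vertex adjacent to the cop, whence η(v) ≤ ω.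
-- Conversely, a robber at (p , q) with p , q > n against a cop at a vertex not dominating
-- (p , q) coordinatewise survives n rounds: he jumps to (p - 1 , Q) or (Q , q - 1) with Q
-- large, and no neighbour of the cop dominates his new position.

coord₁ coord₂ : V → ℕ
coord₁ v = proj₁ (proj₁ v)
coord₂ v = proj₂ (proj₁ v)

Adj-sym : ∀ {u v} → Adj u v → Adj v u
Adj-sym (u≢v , inj₁ (a≡0 , c≡0))               = ≢-sym u≢v , inj₁ (c≡0 , a≡0)
Adj-sym (u≢v , inj₂ (inj₁ (b≡0 , d≡0)))        = ≢-sym u≢v , inj₂ (inj₁ (d≡0 , b≡0))
Adj-sym (u≢v , inj₂ (inj₂ (inj₁ (a<c , d<b)))) = ≢-sym u≢v , inj₂ (inj₂ (inj₂ (a<c , d<b)))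
Adj-sym (u≢v , inj₂ (inj₂ (inj₂ (c<a , b<d)))) = ≢-sym u≢v , inj₂ (inj₂ (inj₁ (c<a , b<d)))

InN-sym : ∀ {u x} → InN u x → InN x u
InN-sym         (inj₁ x≐u) = inj₁ (sym x≐u)
InN-sym {u} {x} (inj₂ adj) = inj₂ (Adj-sym {u} {x} adj)

InN-resp-≐ : ∀ {u v x} → u ≐ v → InN u x → InN v x
InN-resp-≐ {_ , _} {_ , _} refl x∈N[u] = x∈N[u]

Le-refl : ∀ n x → Le n x x
Le-refl zero    x         = refl
Le-refl (suc n) x z z∈N[x] = z , z∈N[x] , inj₂ (Le-refl n z)

Le-suc : ∀ n {u v} → Le n u v → Le (suc n) u v
Le-suc zero {u} {v} u≐v x x∈N[u] = x , InN-resp-≐ {u} {v} {x} u≐v x∈N[u] , inj₂ refl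
Le-suc (suc n)     u≤v x x∈N[u] with u≤v x x∈N[u]
... | y , y∈N[v] , below = y , y∈N[v] , inj₁ below

Below⇒Le : ∀ n {x y} → Below (suc n) x y → Le n x y
Below⇒Le n       (inj₂ x≤y)   = x≤y
Below⇒Le (suc n) (inj₁ below) = Le-suc n (Below⇒Le n below)

-- The offset keeps col k distinct from (0 , 0).
col : ℕ → V
col k = (0 , suc k) , λ ()

column-InN : ∀ u z → coord₁ u ≡ 0 → coord₁ z ≡ 0 → InN u z
column-InN ((_ , b) , _) ((_ , d) , _) refl refl with d ≟ b
... | yes refl = inj₁ refl
... | no d≢b   = inj₂ ((λ eq → d≢b (sym (cong proj₂ eq))) , inj₁ (refl , refl))

col-InN : ∀ k z → coord₁ z ≡ 0 ⊎ coord₂ z ≤ k → InN (col k) z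
col-InN k z@((zero , _) , _) _          = column-InN (col k) z refl refl
col-InN k ((suc _ , _) , _) (inj₂ d≤k) = inj₂ ((λ ()) , inj₂ (inj₂ (inj₁ (s≤s z≤n , s≤s d≤k))))

robber-move : ∀ k x z → coord₂ x ≤ k → InN x z →
              InN (col k) z ⊎ (coord₁ z < coord₁ x × coord₂ x < coord₂ z)
robber-move k _ z b≤k (inj₁ refl)                           = inj₁ (col-InN k z (inj₂ b≤k))
robber-move k _ z _   (inj₂ (_ , inj₁ (_ , z₁≡0)))          = inj₁ (col-InN k z (inj₁ z₁≡0))
robber-move k _ z _   (inj₂ (_ , inj₂ (inj₁ (_ , refl))))   = inj₁ (col-InN k z (inj₂ z≤n))
robber-move k _ z b≤k (inj₂ (_ , inj₂ (inj₂ (inj₁ (_ , d<b))))) =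
  inj₁ (col-InN k z (inj₂ (<⇒≤ (<-≤-trans d<b b≤k))))
robber-move k _ _ _   (inj₂ (_ , inj₂ (inj₂ (inj₂ c<a×b<d)))) = inj₂ c<a×b<d

caught : ∀ m k x → coord₁ x ≤ m → coord₂ x ≤ k → Le (suc m) x (col k)
caught m k x a≤m b≤k z z∈N[x] with robber-move k x z b≤k z∈N[x] | m
... | inj₁ z∈N[col] | n     = z , z∈N[col] , inj₂ (Le-refl n z)
... | inj₂ (c<a , _) | zero  = ⊥-elim (n≮0 (<-≤-trans c<a a≤m))
... | inj₂ (c<a , _) | suc n =
  col (coord₂ z) , column-InN (col k) (col _) refl refl ,
  inj₂ (caught n (coord₂ z) z (≤-pred (<-≤-trans c<a a≤m)) ≤-refl)

η≤ω : (v u : V) → Leω u v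
η≤ω v u x _ =
  col K , InN-sym {col K} {v} (col-InN K v (inj₂ (m≤n+m _ _))) ,
  suc (coord₁ x) , caught (coord₁ x) K x ≤-refl (m≤m+n _ _)
  where
  K : ℕ
  K = coord₂ x + coord₂ v

Evades : ℕ → V → V → Set
Evades n u v = (coord₁ v < coord₁ u ⊎ coord₂ v < coord₂ u) × n < coord₁ u × n < coord₂ u

N-avoids-quadrant : ∀ P Q v y → coord₁ v ≤ suc P → coord₂ v ≤ suc Q →
                    coord₁ v < suc P ⊎ coord₂ v < suc Q → InN v y →
                    coord₁ y < suc P ⊎ coord₂ y < suc Q
N-avoids-quadrant P Q _ _ _ _ v-avoids (inj₁ refl) = v-avoids
N-avoids-quadrant P Q _ ((_ , _) , _) _ _ _ (inj₂ (_ , inj₁ (_ , refl)))        = inj₁ (s≤s z≤n)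
N-avoids-quadrant P Q _ ((_ , _) , _) _ _ _ (inj₂ (_ , inj₂ (inj₁ (_ , refl)))) = inj₂ (s≤s z≤n)
N-avoids-quadrant P Q _ _ _ d≤1+Q _ (inj₂ (_ , inj₂ (inj₂ (inj₁ (_ , d'<d))))) =
  inj₂ (≤-trans d'<d d≤1+Q)
N-avoids-quadrant P Q _ _ c≤1+P _ _ (inj₂ (_ , inj₂ (inj₂ (inj₂ (c'<c , _))))) =
  inj₁ (≤-trans c'<c c≤1+P)

mutual
  escapes : ∀ n u v → Evades n u v → ¬ Le n u v
  escapes zero _ _ (inj₁ c<a , _) u≐v = <-irrefl (cong proj₁ (sym u≐v)) c<a
  escapes zero _ _ (inj₂ d<b , _) u≐v = <-irrefl (cong proj₂ (sym u≐v)) d<b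
  escapes (suc m) u@((suc (suc P) , q) , _) v@((c , d) , _) (inj₁ c<2+P , s≤s (s≤s m≤P) , 1+m<q) =
    escape-step m u v z z∈N[u] z-evades
    where
    z : V
    z = (suc P , suc (q + d)) , λ ()
    z∈N[u] : InN u z
    z∈N[u] = inj₂ ((λ eq → 1+n≢n (cong proj₁ eq)) , inj₂ (inj₂ (inj₂ (n<1+n (suc P) , s≤s (m≤m+n q d)))))
    z-evades : ∀ y → InN v y → Evades m z y
    z-evades y y∈N[v] =
      N-avoids-quadrant P (q + d) v y (≤-pred c<2+P) (m≤n⇒m≤1+n (m≤n+m d q)) (inj₂ (s≤s (m≤n+m d q))) y∈N[v] ,
      s≤s m≤P , s≤s (m≤n⇒m≤n+o d (<⇒≤ (<-trans (n<1+n m) 1+m<q)))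
  escapes (suc m) ((suc zero , _) , _) _ (inj₁ _ , s≤s () , _)
  escapes (suc m) u@((p , suc (suc Q)) , _) v@((c , d) , _) (inj₂ d<2+Q , 1+m<p , s≤s (s≤s m≤Q)) =
    escape-step m u v z z∈N[u] z-evades
    where
    z : V
    z = (suc (p + c) , suc Q) , λ ()
    z∈N[u] : InN u z
    z∈N[u] = inj₂ ((λ eq → 1+n≢n (cong proj₂ eq)) , inj₂ (inj₂ (inj₁ (s≤s (m≤m+n p c) , n<1+n (suc Q)))))
    z-evades : ∀ y → InN v y → Evades m z y
    z-evades y y∈N[v] =
      N-avoids-quadrant (p + c) Q v y (m≤n⇒m≤1+n (m≤n+m c p)) (≤-pred d<2+Q) (inj₁ (s≤s (m≤n+m c p))) y∈N[v] ,
      s≤s (m≤n⇒m≤n+o c (<⇒≤ (<-trans (n<1+n m) 1+m<p))) , s≤s m≤Q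

  escape-step : ∀ m u v z → InN u z → (∀ y → InN v y → Evades m z y) → ¬ Le (suc m) u v
  escape-step m u v z z∈N[u] z-evades u≤v with u≤v z z∈N[u]
  ... | y , y∈N[v] , below = escapes m z y (z-evades y y∈N[v]) (Below⇒Le m below)

η-unbounded : (n : ℕ) → Σ V (λ v → ¬ ((u : V) → Le n u v))
η-unbounded n = col 0 , λ all≤col0 → escapes n u (col 0) u-evades (all≤col0 u)
  where
  u : V
  u = (suc n , suc n) , λ ()
  u-evades : Evades n u (col 0)
  u-evades = inj₁ (s≤s z≤n) , n<1+n n , n<1+n n

theorem3 : RhoIsω
theorem3 = η≤ω , η-unbounded
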